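{- Let $i=i_0i_1i_2\cdots$ be an interaction sequence. Then: (1) if $m\in V(n)$ then $V(i_m)\subseteq V(n)$; (2) if $k,m\in V(n)$ and $k<m$, then $k\in V(i_m)$.
   Context: A pointer sequence is a finite or infinite sequence $i_0i_1i_2\cdots$ of natural numbers with $i_0=0$ and $i_{n+1}<n+1$ for all $n$. It is an interaction sequence if $i_{n+1}\in V(n+1)$ for all $n$, where the finite sets $V(n)$ are defined by $V(0)=\emptyset$ and $V(n+1)=\{n\}\cup V(i_n)$. -}

module Defs where

open import Data.Nat using (ℕ; zero; suc; _<_)
open import Relation.Binary.PropositionalEquality using (_≡_)

record IsPointerSeq (i : ℕ → ℕ) : Set where
  field
    start : i 0 ≡ 0
    back  : ∀ n → i (suc n) < suc n

-- Membership in V(n):  V(0) = ∅,  V(n+1) = {n} ∪ V(i n).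
-- Given inductively; since i n ≤ n for pointer sequences this is exactly
-- the finite set defined by the paper's recursion.
data _∈V[_]_ (m : ℕ) (i : ℕ → ℕ) : ℕ → Set where
  here  : ∀ {n} → m ≡ n → m ∈V[ i ] suc n
  there : ∀ {n} → m ∈V[ i ] (i n) → m ∈V[ i ] suc n

record IsInteractionSeq (i : ℕ → ℕ) : Set where
  field
    pointer  : IsPointerSeq i
    interact : ∀ n → i (suc n) ∈V[ i ] suc n

module Submission where

open import Defs
open import Data.Nat using (ℕ; zero; suc; _≤_; _<_; z≤n; s≤s)
open import Data.Nat.Properties using (<⇒≤; <⇒≱; n<1+n; <-≤-trans)
open import Data.Product using (_×_; _,_)
open import Relation.Binary.PropositionalEquality using (refl)
open import Data.Empty using (⊥-elim)

-- Part (1) holds for any sequence; part (2)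
-- only needs i n ≤ n.

module _ {i : ℕ → ℕ} where

  ∈V-closed-under-pointer : ∀ {m n k} → m ∈V[ i ] n → k ∈V[ i ] (i m) → k ∈V[ i ] n
  ∈V-closed-under-pointer (here refl) k∈V[im] = there k∈V[im]
  ∈V-closed-under-pointer (there m∈V) k∈V[im] = there (∈V-closed-under-pointer m∈V k∈V[im])

  module _ (i≤id : ∀ n → i n ≤ n) where

    ∈V⇒< : ∀ {m n} → m ∈V[ i ] n → m < n
    ∈V⇒< (here refl)           = n<1+n _
    ∈V⇒< {n = suc n} (there p) = s≤s (<⇒≤ (<-≤-trans (∈V⇒< p) (i≤id n)))

    ∈V-below-∈V-pointer : ∀ {k m n} → k ∈V[ i ] n → m ∈V[ i ] n → k < m → k ∈V[ i ] (i m)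
    ∈V-below-∈V-pointer (here refl) m∈V k<m with ∈V⇒< m∈V
    ... | s≤s m≤k = ⊥-elim (<⇒≱ k<m m≤k)
    ∈V-below-∈V-pointer (there k∈V) (here refl) _  = k∈V
    ∈V-below-∈V-pointer (there k∈V) (there m∈V) k<m = ∈V-below-∈V-pointer k∈V m∈V k<m

pointer≤id : ∀ {i} → IsPointerSeq i → ∀ n → i n ≤ n
pointer≤id P zero rewrite IsPointerSeq.start P = z≤n
pointer≤id P (suc n) = <⇒≤ (IsPointerSeq.back P n)

mainTheorem10 : (i : ℕ → ℕ) → IsInteractionSeq i →
    (∀ m n → m ∈V[ i ] n → ∀ k → k ∈V[ i ] (i m) → k ∈V[ i ] n)
    × (∀ k m n → k ∈V[ i ] n → m ∈V[ i ] n → k < m → k ∈V[ i ] (i m))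
mainTheorem10 i I =
    (λ m n m∈V k → ∈V-closed-under-pointer m∈V)
  , (λ k m n → ∈V-below-∈V-pointer (pointer≤id (IsInteractionSeq.pointer I)))
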